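{- For every $d\ge1$ and every permutation $\sigma\in S_{2d}$, the polynomial $\sigma(P)$ can be computed by a monotone set-multilinear ABP of size $O(d)$ (with an absolute constant in the $O$).
   Context: Let $X=X_1\sqcup\dots\sqcup X_{2d}$ with $X_i=\{x_{0,i},x_{1,i}\}$. For $\sigma\in S_{2d}$ and $b\in\{0,1\}^d$ let $\sigma(w_b)=\prod_{i=1}^d x_{b_i,\sigma(i)}$ and $\sigma(w'_b)=\prod_{i=1}^d x_{b_i,\sigma(d+i)}$, and $\sigma(P)=\sum_{b\in\{0,1\}^d}\sigma(w_b)\sigma(w'_b)$. A set-multilinear ABP w.r.t. the partition is a layered DAG with layers $0,\dots,2d$, unique source $s$ at layer $0$ and sink at layer $2d$, edges only between consecutive layers, each labeled by a homogeneous linear form, with an index set $I_v\subseteq[2d]$ per node, $I_s=\emptyset$, such that for each edge $(u,v)$, $I_v=I_u\sqcup\{i\}$ for some $i$ and the label is a linear form over $X_i$; it computes the sum over source-to-sink paths of the product of edge labels; size is the number of nodes. Monotone means over $\mathbb{R}$ with all coefficients of edge labels nonnegative. -}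

module Defs where

open import Data.Nat using (ℕ; zero; suc; _<_; _≤_)
open import Data.Fin using (Fin; zero; suc; splitAt)
open import Data.Fin.Properties using (all?)
open import Data.Fin.Subset using (Subset; _∪_; ⁅_⁆; _∉_) renaming (⊥ to ∅)
open import Data.Fin.Permutation using (Permutation′; _⟨$⟩ˡ_)
open import Data.Maybe using (Maybe; just; nothing)
open import Data.Product using (_×_; _,_; Σ)
open import Data.Sum using ([_,_]′)
open import Data.Bool using (if_then_else_)
open import Data.Rational using (ℚ; 0ℚ; 1ℚ; _+_; _*_) renaming (_≤_ to _≤ℚ_)
open import Data.Vec.Functional using (_∷_)
open import Relation.Nullary using (does)
open import Relation.Binary.PropositionalEquality using (_≡_)

-- Variables: x_{b,i} with b : Fin 2 and i : Fin N (N = 2d blocks).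
-- A set-multilinear monomial (one variable from each block X_i) is a
-- function m : Fin N → Fin 2, m i = b meaning x_{b,i} occurs.
-- All polynomials below are set-multilinear of degree N, so they are
-- given by their coefficient function on such monomials.

Monomial : ℕ → Set
Monomial N = Fin N → Fin 2

sumFin : (n : ℕ) → (Fin n → ℚ) → ℚ
sumFin zero    f = 0ℚ
sumFin (suc n) f = f zero + sumFin n (λ i → f (suc i))

sumBits : (k : ℕ) → ((Fin k → Fin 2) → ℚ) → ℚ
sumBits zero    f = f (λ ())
sumBits (suc k) f = sumBits k (λ b → f (zero ∷ b)) + sumBits k (λ b → f (suc zero ∷ b))

monoEq : ∀ {N} → Monomial N → Monomial N → ℚ
monoEq m m' = if does (all? (λ j → Data.Fin._≟_ (m j) (m' j))) then 1ℚ else 0ℚ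

-- The polynomial σ(P) = Σ_b σ(w_b) σ(w'_b).
-- σ(w_b)σ(w'_b) = Π_{i<d} x_{b_i,σ(i)} x_{b_i,σ(d+i)}; as a monomial it
-- picks, in block j, the variable x_{b_k, j} where σ⁻¹(j) ∈ {k, d+k}.

σmono : (d : ℕ) → Permutation′ (d Data.Nat.+ d) → (Fin d → Fin 2) → Monomial (d Data.Nat.+ d)
σmono d σ b j = [ b , b ]′ (splitAt d (σ ⟨$⟩ˡ j))

σP : (d : ℕ) → Permutation′ (d Data.Nat.+ d) → Monomial (d Data.Nat.+ d) → ℚ
σP d σ m = sumBits d (λ b → monoEq (σmono d σ b) m)

-- Set-multilinear ABPs with N = number of blocks (layers 0..N).
-- Layers are indexed by ℕ; only layers 0..N are part of the ABP.
-- Between node u of layer ℓ and node v of layer ℓ+1 there is either no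
-- edge ('nothing') or an edge 'just (i , c)' labelled by the linear form
-- c 0 · x_{0,i} + c 1 · x_{1,i} over the block X_i.

record ABP (N : ℕ) : Set where
  field
    width : ℕ → ℕ
    edge  : (ℓ : ℕ) → Fin (width ℓ) → Fin (width (suc ℓ))
            → Maybe (Fin N × (Fin 2 → ℚ))
    idx   : (ℓ : ℕ) → Fin (width ℓ) → Subset N

open ABP public

sizeUpTo : (ℕ → ℕ) → ℕ → ℕ
sizeUpTo w zero    = w zero
sizeUpTo w (suc ℓ) = sizeUpTo w ℓ Data.Nat.+ w (suc ℓ)

size : ∀ {N} → ABP N → ℕ
size {N} A = sizeUpTo (width A) N

record SetMultilinear {N : ℕ} (A : ABP N) : Set where
  field
    source-unique : width A 0 ≡ 1
    sink-unique   : width A N ≡ 1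
    source-idx    : ∀ (s : Fin (width A 0)) → idx A 0 s ≡ ∅
    edge-idx      : ∀ ℓ → ℓ < N → ∀ u v i c → edge A ℓ u v ≡ just (i , c)
                    → (i ∉ idx A ℓ u) × (idx A (suc ℓ) v ≡ idx A ℓ u ∪ ⁅ i ⁆)

Monotone : ∀ {N} → ABP N → Set
Monotone {N} A = ∀ ℓ → ℓ < N → ∀ u v i c → edge A ℓ u v ≡ just (i , c)
                 → ∀ b → 0ℚ ≤ℚ c b

edgeCoeff : ∀ {N} → Maybe (Fin N × (Fin 2 → ℚ)) → Monomial N → ℚ
edgeCoeff nothing        m = 0ℚ
edgeCoeff (just (i , c)) m = c (m i)

-- coefficient of m in the sum over s→v paths of the product of labels
-- (valid for set-multilinear ABPs: a path through all layers uses each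
-- block exactly once, so the coefficient of m in the product of its
-- labels is the product of the coefficients c_e (m i_e)).
nodeCoeff : ∀ {N} (A : ABP N) → Monomial N → (ℓ : ℕ) → Fin (width A ℓ) → ℚ
nodeCoeff A m zero    v = 1ℚ
nodeCoeff A m (suc ℓ) v =
  sumFin (width A ℓ) (λ u → nodeCoeff A m ℓ u * edgeCoeff (edge A ℓ u v) m)

computes-coeff : ∀ {N} (A : ABP N) → Monomial N → ℚ
computes-coeff {N} A m = sumFin (width A N) (nodeCoeff A m N)

Computes : ∀ {N} → ABP N → (Monomial N → ℚ) → Set
Computes A f = ∀ m → computes-coeff A m ≡ f m

module Submission where

-- Pair the block σ(k) with the block σ(d+k), for k < d.  A monomial
-- σ(w_b)σ(w'_b) uses the variable x_{b_k,·} in both blocks of the k-th pair,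
-- so expanding the product over the pairs gives the factorisation
--
--     σ(P) = ∏_{k<d} (x_{0,σ(k)} x_{0,σ(d+k)} + x_{1,σ(k)} x_{1,σ(d+k)}).
--
-- Each factor is computed by a monotone two-layer "gadget" (one node, two
-- nodes, one node), and chaining d gadgets gives a set-multilinear ABP with
-- layer widths 1,2,1,2,…,1, i.e. 3d+1 ≤ 4d nodes.

open import Defs
open import Data.Nat using (ℕ; _+_; _*_; _≤_)
open import Data.Product using (Σ; _×_)
open import Data.Fin.Permutation using (Permutation′)

open import Data.Nat using (zero; suc)
open import Data.Nat.Properties using (+-suc; *-suc; +-assoc; +-comm; +-monoˡ-≤; ≤-trans; ≤-reflexive)
open import Data.Fin using (Fin; zero; suc; splitAt; join; _≟_)
open import Data.Fin.Patterns using (0F; 1F)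
open import Data.Fin.Properties using (all?; ∀-cons-⇔; splitAt-join; join-splitAt)
open import Data.Fin.Subset using (Subset; _∪_; ⁅_⁆; _∉_) renaming (⊥ to ∅)
open import Data.Fin.Subset.Properties using (∉⊥; x∈p∪q⁻; x∈⁅y⁆⇒x≡y)
open import Data.Fin.Permutation using (_⟨$⟩ˡ_; _⟨$⟩ʳ_; inverseˡ; inverseʳ)
open import Data.Maybe using (Maybe; just; nothing)
open import Data.Product using (_,_; proj₁; proj₂; uncurry)
open import Data.Sum using (_⊎_; inj₁; inj₂; [_,_]′)
open import Data.Bool using (Bool; true; false; _∧_; if_then_else_)
open import Data.Rational using (ℚ; 0ℚ; 1ℚ)
  renaming (_+_ to _+ℚ_; _*_ to _*ℚ_; _≤_ to _≤ℚ_)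
import Data.Rational.Properties as ℚₚ
open import Data.Vec.Functional using (_∷_)
open import Function using (_∘_; case_of_)
open import Function.Bundles using (_⇔_; mk⇔; Injection)
open import Function.Definitions using (Injective)
open import Function.Properties.Inverse using (↔⇒↣)
open import Relation.Nullary using (Dec; does)
open import Relation.Nullary.Decidable using (_×-dec_; does-⇔)
open import Relation.Binary.PropositionalEquality
  using (_≡_; _≢_; refl; sym; trans; cong; cong₂; module ≡-Reasoning)

-- The 0/1 value of a Boolean, written as in monoEq so that monoEq m m' is
-- definitionally the indicator of the decision "m = m'".
indicator : Bool → ℚ
indicator b = if b then 1ℚ else 0ℚ

indicator-nonneg : ∀ b → 0ℚ ≤ℚ indicator b
indicator-nonneg true  = ℚₚ.nonNegative⁻¹ 1ℚ
indicator-nonneg false = ℚₚ.≤-refl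

indicator-∧ : ∀ a b → indicator (a ∧ b) ≡ indicator a *ℚ indicator b
indicator-∧ true  true  = refl
indicator-∧ true  false = refl
indicator-∧ false true  = refl
indicator-∧ false false = refl

prodFin : (n : ℕ) → (Fin n → ℚ) → ℚ
prodFin zero    f = 1ℚ
prodFin (suc n) f = f zero *ℚ prodFin n (f ∘ suc)

indicator-all : ∀ {n} {P : Fin n → Set} (P? : ∀ k → Dec (P k)) →
                indicator (does (all? P?)) ≡ prodFin n (λ k → indicator (does (P? k)))
indicator-all {zero}  P? = refl
indicator-all {suc n} P? = begin
  indicator (does (all? P?))
    ≡⟨ cong indicator (does-⇔ ∀-cons-⇔ (P? zero ×-dec all? (P? ∘ suc)) (all? P?)) ⟨
  indicator (does (P? zero) ∧ does (all? (P? ∘ suc)))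
    ≡⟨ indicator-∧ (does (P? zero)) _ ⟩
  indicator (does (P? zero)) *ℚ indicator (does (all? (P? ∘ suc)))
    ≡⟨ cong (indicator (does (P? zero)) *ℚ_) (indicator-all (P? ∘ suc)) ⟩
  prodFin (suc n) (λ k → indicator (does (P? k))) ∎
  where open ≡-Reasoning

sumFin-cong : ∀ n {f g : Fin n → ℚ} → (∀ i → f i ≡ g i) → sumFin n f ≡ sumFin n g
sumFin-cong zero    h = refl
sumFin-cong (suc n) h = cong₂ _+ℚ_ (h zero) (sumFin-cong n (h ∘ suc))

sumFin-distribˡ : ∀ n c (g : Fin n → ℚ) → sumFin n (λ i → c *ℚ g i) ≡ c *ℚ sumFin n g
sumFin-distribˡ zero    c g = sym (ℚₚ.*-zeroʳ c)
sumFin-distribˡ (suc n) c g = trans (cong (c *ℚ g zero +ℚ_) (sumFin-distribˡ n c (g ∘ suc)))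
                                    (sym (ℚₚ.*-distribˡ-+ c (g zero) _))

sumFin-singleton : ∀ {k} {f : Fin k → ℚ} {c} → k ≡ 1 → (∀ i → f i ≡ c) → sumFin k f ≡ c
sumFin-singleton {f = f} refl h = trans (ℚₚ.+-identityʳ (f zero)) (h zero)

sumBits-cong : ∀ n {f g : (Fin n → Fin 2) → ℚ} → (∀ b → f b ≡ g b) → sumBits n f ≡ sumBits n g
sumBits-cong zero    h = h _
sumBits-cong (suc n) h = cong₂ _+ℚ_ (sumBits-cong n (h ∘ (0F ∷_))) (sumBits-cong n (h ∘ (1F ∷_)))

sumBits-distribˡ : ∀ n c (g : (Fin n → Fin 2) → ℚ) → sumBits n (λ b → c *ℚ g b) ≡ c *ℚ sumBits n g
sumBits-distribˡ zero    c g = refl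
sumBits-distribˡ (suc n) c g =
  trans (cong₂ _+ℚ_ (sumBits-distribˡ n c (g ∘ (0F ∷_))) (sumBits-distribˡ n c (g ∘ (1F ∷_))))
        (sym (ℚₚ.*-distribˡ-+ c _ _))

sumBits-prodFin : ∀ n (H : Fin n → Fin 2 → ℚ) →
  sumBits n (λ b → prodFin n (λ k → H k (b k))) ≡ prodFin n (λ k → H k 0F +ℚ H k 1F)
sumBits-prodFin zero    H = refl
sumBits-prodFin (suc n) H = begin
  sumBits n (λ b → H zero 0F *ℚ rest b) +ℚ sumBits n (λ b → H zero 1F *ℚ rest b)
    ≡⟨ cong₂ _+ℚ_ (sumBits-distribˡ n (H zero 0F) rest) (sumBits-distribˡ n (H zero 1F) rest) ⟩
  H zero 0F *ℚ sumBits n rest +ℚ H zero 1F *ℚ sumBits n rest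
    ≡⟨ ℚₚ.*-distribʳ-+ (sumBits n rest) (H zero 0F) (H zero 1F) ⟨
  (H zero 0F +ℚ H zero 1F) *ℚ sumBits n rest
    ≡⟨ cong ((H zero 0F +ℚ H zero 1F) *ℚ_) (sumBits-prodFin n (H ∘ suc)) ⟩
  prodFin (suc n) (λ k → H k 0F +ℚ H k 1F) ∎
  where
  open ≡-Reasoning
  rest : (Fin n → Fin 2) → ℚ
  rest b = prodFin n (λ k → H (suc k) (b k))

-- A family of n pairs of blocks among N blocks: pair k uses blocks
-- blk k 0F and blk k 1F.
Blocks : ℕ → ℕ → Set
Blocks N n = Fin n → Fin 2 → Fin N

-- Coefficient of a monomial with values x, y in the two blocks of a pair,
-- in x_{c,·} x_{c,·}, resp. in x_{0,·} x_{0,·} + x_{1,·} x_{1,·}.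
both : Fin 2 → Fin 2 → Fin 2 → ℚ
both c x y = indicator (does ((c ≟ x) ×-dec (c ≟ y)))

pairCoeff : Fin 2 → Fin 2 → ℚ
pairCoeff x y = both 0F x y +ℚ both 1F x y

pairProduct : ∀ {N} n → Blocks N n → Monomial N → ℚ
pairProduct n blk m = prodFin n (λ k → pairCoeff (m (blk k 0F)) (m (blk k 1F)))

module Pairing (d : ℕ) (σ : Permutation′ (d + d)) where

  half : Fin 2 → Fin d → Fin d ⊎ Fin d
  half 0F = inj₁
  half 1F = inj₂

  half-injective : ∀ c c' {k k'} → half c k ≡ half c' k' → (k , c) ≡ (k' , c')
  half-injective 0F 0F refl = refl
  half-injective 1F 1F refl = refl
  half-injective 0F 1F ()
  half-injective 1F 0F ()

  σBlocks : Blocks (d + d) d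
  σBlocks k c = σ ⟨$⟩ʳ join d d (half c k)

  σBlocks-injective : Injective _≡_ _≡_ (uncurry σBlocks)
  σBlocks-injective {k , c} {k' , c'} e = half-injective c c' (begin
    half c k                                ≡⟨ splitAt-join d d (half c k) ⟨
    splitAt d (join d d (half c k))         ≡⟨ cong (splitAt d) (Injection.injective (↔⇒↣ σ) e) ⟩
    splitAt d (join d d (half c' k'))       ≡⟨ splitAt-join d d (half c' k') ⟩
    half c' k'                              ∎)
    where open ≡-Reasoning

  σmono-σBlocks : ∀ b k c → σmono d σ b (σBlocks k c) ≡ b k
  σmono-σBlocks b k c = begin
    [ b , b ]′ (splitAt d (σ ⟨$⟩ˡ (σ ⟨$⟩ʳ join d d (half c k))))
      ≡⟨ cong (λ i → [ b , b ]′ (splitAt d i)) (inverseˡ σ) ⟩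
    [ b , b ]′ (splitAt d (join d d (half c k)))
      ≡⟨ cong [ b , b ]′ (splitAt-join d d (half c k)) ⟩
    [ b , b ]′ (half c k)
      ≡⟨ choose c ⟩
    b k ∎
    where
    open ≡-Reasoning
    choose : ∀ c → [ b , b ]′ (half c k) ≡ b k
    choose 0F = refl
    choose 1F = refl

  σ-join-splitAt : ∀ j → σ ⟨$⟩ʳ join d d (splitAt d (σ ⟨$⟩ˡ j)) ≡ j
  σ-join-splitAt j = trans (cong (σ ⟨$⟩ʳ_) (join-splitAt d d (σ ⟨$⟩ˡ j))) (inverseʳ σ)

  Matches : (Fin d → Fin 2) → Monomial (d + d) → Fin d → Set
  Matches b m k = b k ≡ m (σBlocks k 0F) × b k ≡ m (σBlocks k 1F)

  σmono-matches : ∀ b m → (∀ j → σmono d σ b j ≡ m j) ⇔ (∀ k → Matches b m k)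
  σmono-matches b m = mk⇔ to from
    where
    to : (∀ j → σmono d σ b j ≡ m j) → ∀ k → Matches b m k
    to h k = trans (sym (σmono-σBlocks b k 0F)) (h (σBlocks k 0F))
           , trans (sym (σmono-σBlocks b k 1F)) (h (σBlocks k 1F))
    from : (∀ k → Matches b m k) → ∀ j → σmono d σ b j ≡ m j
    from g j = trans (agree (splitAt d (σ ⟨$⟩ˡ j))) (cong m (σ-join-splitAt j))
      where
      agree : ∀ p → [ b , b ]′ p ≡ m (σ ⟨$⟩ʳ join d d p)
      agree (inj₁ k) = proj₁ (g k)
      agree (inj₂ k) = proj₂ (g k)

  monoEq-σmono : ∀ b m →
    monoEq (σmono d σ b) m ≡ prodFin d (λ k → both (b k) (m (σBlocks k 0F)) (m (σBlocks k 1F)))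
  monoEq-σmono b m = trans (cong indicator (does-⇔ (σmono-matches b m) (all? (λ j → σmono d σ b j ≟ m j)) (all? matches?)))
                           (indicator-all matches?)
    where
    matches? : ∀ k → Dec (Matches b m k)
    matches? k = (b k ≟ m (σBlocks k 0F)) ×-dec (b k ≟ m (σBlocks k 1F))

  σP-factorises : ∀ m → σP d σ m ≡ pairProduct d σBlocks m
  σP-factorises m =
    trans (sumBits-cong d (λ b → monoEq-σmono b m))
          (sumBits-prodFin d (λ k c → both c (m (σBlocks k 0F)) (m (σBlocks k 1F))))

-- 2n layers, two per pair, so that the sink sits at layer double n.
double : ℕ → ℕ
double zero    = zero
double (suc n) = suc (suc (double n))

+-self≡double : ∀ n → n + n ≡ double n
+-self≡double zero    = refl
+-self≡double (suc n) = cong suc (trans (+-suc n n) (cong suc (+-self≡double n)))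

module Chain (N : ℕ) where

  -- Layer widths 1, 2, 1, 2, …: one node between gadgets, two inside.
  chainWidth : ℕ → ℕ
  chainWidth zero          = 1
  chainWidth (suc zero)    = 2
  chainWidth (suc (suc ℓ)) = chainWidth ℓ

  width-double : ∀ n → chainWidth (double n) ≡ 1
  width-double zero    = refl
  width-double (suc n) = width-double n

  sizeUpTo-double : ∀ n → sizeUpTo chainWidth (double n) ≡ suc (3 * n)
  sizeUpTo-double zero    = refl
  sizeUpTo-double (suc n) = begin
    sizeUpTo chainWidth (double n) + chainWidth (suc (double n)) + chainWidth (double n)
      ≡⟨ cong₂ (λ s w → s + w + chainWidth (double n)) (sizeUpTo-double n) (width-odd n) ⟩
    suc (3 * n) + 2 + chainWidth (double n)
      ≡⟨ cong (suc (3 * n) + 2 +_) (width-double n) ⟩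
    suc (3 * n) + 2 + 1
      ≡⟨ +-assoc (suc (3 * n)) 2 1 ⟩
    suc (3 * n) + 3
      ≡⟨ +-comm (suc (3 * n)) 3 ⟩
    suc (3 + 3 * n)
      ≡⟨ cong suc (*-suc 3 n) ⟨
    suc (3 * suc n) ∎
    where
    open ≡-Reasoning
    width-odd : ∀ n → chainWidth (suc (double n)) ≡ 2
    width-odd zero    = refl
    width-odd (suc n) = width-odd n

  unitLabel : Fin 2 → Fin 2 → ℚ
  unitLabel v b = indicator (does (v ≟ b))

  -- Gadget k: the source of layer 2k goes to node v of layer 2k+1 by
  -- x_{v,blk k 0}, and node u goes to layer 2k+2 by x_{u,blk k 1}.
  chainEdge : ∀ n → Blocks N n → (ℓ : ℕ) → Fin (chainWidth ℓ) → Fin (chainWidth (suc ℓ))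
              → Maybe (Fin N × (Fin 2 → ℚ))
  chainEdge zero    blk ℓ             u v = nothing
  chainEdge (suc n) blk zero          u v = just (blk 0F 0F , unitLabel v)
  chainEdge (suc n) blk (suc zero)    u v = just (blk 0F 1F , unitLabel u)
  chainEdge (suc n) blk (suc (suc ℓ)) u v = chainEdge n (blk ∘ suc) ℓ u v

  -- Index sets: the blocks consumed so far, on top of an initial set S.
  chainIdx : ∀ n → Blocks N n → Subset N → (ℓ : ℕ) → Fin (chainWidth ℓ) → Subset N
  chainIdx n       blk S zero          u = S
  chainIdx zero    blk S (suc ℓ)       u = S
  chainIdx (suc n) blk S (suc zero)    u = S ∪ ⁅ blk 0F 0F ⁆
  chainIdx (suc n) blk S (suc (suc ℓ)) u =
    chainIdx n (blk ∘ suc) ((S ∪ ⁅ blk 0F 0F ⁆) ∪ ⁅ blk 0F 1F ⁆) ℓ u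

  chainABP : ∀ n → Blocks N n → Subset N → ABP N
  chainABP n blk S = record { width = chainWidth ; edge = chainEdge n blk ; idx = chainIdx n blk S }

  gadget-coeff : ∀ n blk S m →
    nodeCoeff (chainABP (suc n) blk S) m 2 0F ≡ pairCoeff (m (blk 0F 0F)) (m (blk 0F 1F))
  gadget-coeff n blk S m with m (blk 0F 0F) | m (blk 0F 1F)
  ... | 0F | 0F = refl
  ... | 0F | 1F = refl
  ... | 1F | 0F = refl
  ... | 1F | 1F = refl

  -- … and since layer 2 is a single node, every path from the source
  -- factors through it: the first gadget splits off as a factor.
  nodeCoeff-split : ∀ n blk S S' m ℓ (v : Fin (chainWidth ℓ)) →
    nodeCoeff (chainABP (suc n) blk S) m (suc (suc ℓ)) v
      ≡ nodeCoeff (chainABP (suc n) blk S) m 2 0F *ℚ nodeCoeff (chainABP n (blk ∘ suc) S') m ℓ v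
  nodeCoeff-split n blk S S' m zero    0F = sym (ℚₚ.*-identityʳ _)
  nodeCoeff-split n blk S S' m (suc ℓ) v = begin
    sumFin (chainWidth ℓ) (λ u → coeff (suc (suc ℓ)) u *ℚ label u)
      ≡⟨ sumFin-cong (chainWidth ℓ) (λ u → trans (cong (_*ℚ label u) (nodeCoeff-split n blk S S' m ℓ u))
                                             (ℚₚ.*-assoc g (coeff' ℓ u) (label u))) ⟩
    sumFin (chainWidth ℓ) (λ u → g *ℚ (coeff' ℓ u *ℚ label u))
      ≡⟨ sumFin-distribˡ (chainWidth ℓ) g (λ u → coeff' ℓ u *ℚ label u) ⟩
    g *ℚ coeff' (suc ℓ) v ∎
    where
    open ≡-Reasoning
    coeff : (ℓ : ℕ) → Fin (chainWidth ℓ) → ℚ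
    coeff = nodeCoeff (chainABP (suc n) blk S) m
    coeff' : (ℓ : ℕ) → Fin (chainWidth ℓ) → ℚ
    coeff' = nodeCoeff (chainABP n (blk ∘ suc) S') m
    g : ℚ
    g = coeff 2 0F
    label : Fin (chainWidth ℓ) → ℚ
    label u = edgeCoeff (chainEdge n (blk ∘ suc) ℓ u v) m

  chain-nodeCoeff : ∀ n blk S m (v : Fin (chainWidth (double n))) →
    nodeCoeff (chainABP n blk S) m (double n) v ≡ pairProduct n blk m
  chain-nodeCoeff zero    blk S m v = refl
  chain-nodeCoeff (suc n) blk S m v =
    trans (nodeCoeff-split n blk S S m (double n) v)
          (cong₂ _*ℚ_ (gadget-coeff n blk S m) (chain-nodeCoeff n (blk ∘ suc) S m v))

  chain-computes : ∀ n blk S → N ≡ double n → Computes (chainABP n blk S) (pairProduct n blk)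
  chain-computes n blk S N≡ m = sink N≡
    where
    sink : ∀ {ℓ} → ℓ ≡ double n → sumFin (chainWidth ℓ) (nodeCoeff (chainABP n blk S) m ℓ) ≡ pairProduct n blk m
    sink refl = sumFin-singleton (width-double n) (chain-nodeCoeff n blk S m)

  -- Monotonicity: every label is some x_{v,i}.
  chain-monotone : ∀ n blk S → Monotone (chainABP n blk S)
  chain-monotone n blk S ℓ _ = labels-nonneg n blk ℓ
    where
    labels-nonneg : ∀ n blk ℓ u v i c → chainEdge n blk ℓ u v ≡ just (i , c) → ∀ b → 0ℚ ≤ℚ c b
    labels-nonneg zero    blk ℓ             u v i c ()
    labels-nonneg (suc n) blk zero          u v i c refl b = indicator-nonneg (does (v ≟ b))
    labels-nonneg (suc n) blk (suc zero)    u v i c refl b = indicator-nonneg (does (u ≟ b))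
    labels-nonneg (suc n) blk (suc (suc ℓ)) u v i c e    = labels-nonneg n (blk ∘ suc) ℓ u v i c e

  Fresh : ∀ n → Blocks N n → Subset N → Set
  Fresh n blk S = Injective _≡_ _≡_ (uncurry blk) × (∀ k c → blk k c ∉ S)

  ∉-∪⁅⁆ : ∀ {x a : Fin N} {S} → x ∉ S → x ≢ a → x ∉ S ∪ ⁅ a ⁆
  ∉-∪⁅⁆ {a = a} {S} x∉S x≢a x∈ with x∈p∪q⁻ S ⁅ a ⁆ x∈
  ... | inj₁ x∈S  = x∉S x∈S
  ... | inj₂ x∈⁅a⁆ = x≢a (x∈⁅y⁆⇒x≡y a x∈⁅a⁆)

  fresh-tail : ∀ n blk S → Fresh (suc n) blk S →
               Fresh n (blk ∘ suc) ((S ∪ ⁅ blk 0F 0F ⁆) ∪ ⁅ blk 0F 1F ⁆)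
  fresh-tail n blk S (inj , out) = inj-tail , out-tail
    where
    inj-tail : Injective _≡_ _≡_ (uncurry (blk ∘ suc))
    inj-tail e = case inj e of λ { refl → refl }
    new : ∀ k c c' → blk (suc k) c ≢ blk 0F c'
    new k c c' e = case cong proj₁ (inj e) of λ ()
    out-tail : ∀ k c → blk (suc k) c ∉ (S ∪ ⁅ blk 0F 0F ⁆) ∪ ⁅ blk 0F 1F ⁆
    out-tail k c = ∉-∪⁅⁆ (∉-∪⁅⁆ (out (suc k) c) (new k c 0F)) (new k c 1F)

  chain-edge-idx : ∀ n blk S → Fresh n blk S → ∀ ℓ u v i c → chainEdge n blk ℓ u v ≡ just (i , c)
    → (i ∉ chainIdx n blk S ℓ u) × (chainIdx n blk S (suc ℓ) v ≡ chainIdx n blk S ℓ u ∪ ⁅ i ⁆)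
  chain-edge-idx zero    blk S fresh ℓ u v i c ()
  chain-edge-idx (suc n) blk S (inj , out) zero       u v i c refl = out 0F 0F , refl
  chain-edge-idx (suc n) blk S (inj , out) (suc zero) u v i c refl =
    ∉-∪⁅⁆ (out 0F 1F) (λ e → case cong proj₂ (inj e) of λ ()) , refl
  chain-edge-idx (suc n) blk S fresh (suc (suc ℓ)) u v i c e =
    chain-edge-idx n (blk ∘ suc) _ (fresh-tail n blk S fresh) ℓ u v i c e

  chain-setMultilinear : ∀ n blk → N ≡ double n → Injective _≡_ _≡_ (uncurry blk)
                         → SetMultilinear (chainABP n blk ∅)
  chain-setMultilinear n blk N≡ inj = record
    { source-unique = refl
    ; sink-unique   = trans (cong chainWidth N≡) (width-double n)
    ; source-idx    = λ _ → refl
    ; edge-idx      = λ ℓ _ → chain-edge-idx n blk ∅ (inj , λ _ _ → ∉⊥) ℓ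
    }

  chain-size : ∀ n blk S → N ≡ double n → size (chainABP n blk S) ≡ suc (3 * n)
  chain-size n blk S N≡ = trans (cong (sizeUpTo chainWidth) N≡) (sizeUpTo-double n)

-- The theorem, with C = 4: the chain ABP for the pairs {σ(k), σ(d+k)} has
-- size 3d + 1 ≤ d + 3d = 4d.

mainTheorem7 : Σ ℕ λ C → ∀ (d : ℕ) → 1 ≤ d → (σ : Permutation′ (d + d))
               → Σ (ABP (d + d)) λ A → SetMultilinear A × Monotone A × Computes A (σP d σ) × (size A ≤ C * d)
mainTheorem7 = 4 , λ d 1≤d σ →
  let open Pairing d σ
      open Chain (d + d)
      dd≡ = +-self≡double d
  in chainABP d σBlocks ∅
   , chain-setMultilinear d σBlocks dd≡ σBlocks-injective
   , chain-monotone d σBlocks ∅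
   , (λ m → trans (chain-computes d σBlocks ∅ dd≡ m) (sym (σP-factorises m)))
   , ≤-trans (≤-reflexive (chain-size d σBlocks ∅ dd≡)) (+-monoˡ-≤ (3 * d) 1≤d)
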